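{- For every positive integer $n$, the only $n\times n$ magog matrix whose entry in row $1$, column $1$ equals $1$ is the identity matrix.
   Context: An $n\times n$ magog matrix is an $n\times n$ matrix $A=(a_{ij})$ with entries in $\{0,1,-1\}$ such that all row sums and all column sums equal $1$, $0\le \sum_{i'=1}^{i}a_{i'j}\le 1$ for all $1\le i,j\le n$, $\sum_{j'=1}^{j}a_{ij'}\ge 0$ for all $1\le i,j\le n$, and for all $1\le i\le n-2$, $1\le j\le n-2$, $$\sum_{j'=1}^{j}a_{i+1,j'}+\sum_{i'=1}^{i+1}a_{i',j+1}-\sum_{i'=1}^{i}a_{i'j}\ge 0.$$ -}

module Defs where

open import Data.Nat using (ℕ; zero; suc; _<_; _≤_; _<?_; _∸_)
open import Data.Fin using (Fin; toℕ; fromℕ<)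
open import Data.Integer using (ℤ; _+_; _≤_; -_) renaming (+_ to ℤ+)
open import Data.Sum using (_⊎_)
open import Relation.Nullary using (yes; no)
open import Relation.Binary.PropositionalEquality using (_≡_)

-- An n×n integer matrix, rows and columns indexed 0..n-1 (paper's index k ↔ Fin index k-1).
Matrix : ℕ → Set
Matrix n = Fin n → Fin n → ℤ

-- Entry lookup with natural-number (0-based) indices; 0 outside the range.
entry : ∀ {n} → Matrix n → ℕ → ℕ → ℤ
entry {n} A i j with i <? n | j <? n
... | yes i<n | yes j<n = A (fromℕ< i<n) (fromℕ< j<n)
... | _ | _ = ℤ+ 0

sumTo : ℕ → (ℕ → ℤ) → ℤ
sumTo zero f = ℤ+ 0
sumTo (suc m) f = sumTo m f + f m

rowPre : ∀ {n} → Matrix n → ℕ → ℕ → ℤ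
rowPre A i j = sumTo (suc j) (λ j' → entry A i j')

colPre : ∀ {n} → Matrix n → ℕ → ℕ → ℤ
colPre A i j = sumTo (suc i) (λ i' → entry A i' j)

IsMagog : (n : ℕ) → Matrix n → Set
IsMagog n A =
    (∀ i j → (A i j ≡ ℤ+ 0) ⊎ ((A i j ≡ ℤ+ 1) ⊎ (A i j ≡ - ℤ+ 1)))
  × (∀ (i : Fin n) → rowPre A (toℕ i) (n ∸ 1) ≡ ℤ+ 1)
  × (∀ (j : Fin n) → colPre A (n ∸ 1) (toℕ j) ≡ ℤ+ 1)
  × (∀ (i j : Fin n) → (ℤ+ 0 Data.Integer.≤ colPre A (toℕ i) (toℕ j))
                      × (colPre A (toℕ i) (toℕ j) Data.Integer.≤ ℤ+ 1))
  × (∀ (i j : Fin n) → ℤ+ 0 Data.Integer.≤ rowPre A (toℕ i) (toℕ j))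
  -- paper's condition for 1 ≤ i, j ≤ n-2 (1-based); here i, j are 0-based with i, j < n-2
  × (∀ (i j : ℕ) → suc i Data.Nat.≤ n ∸ 2 → suc j Data.Nat.≤ n ∸ 2 →
       ℤ+ 0 Data.Integer.≤ (rowPre A (suc i) j + colPre A (suc i) (suc j)) + (- colPre A i j))
  where open import Data.Product using (_×_)

idMatrix : (n : ℕ) → Matrix n
idMatrix n i j with toℕ i Data.Nat.≟ toℕ j
... | yes _ = ℤ+ 1
... | no _ = ℤ+ 0

{-# OPTIONS --safe #-}
-- By induction on k, rows and columns 0, …, k-1 of the matrix coincide with those of the
-- identity. Then row k and column k vanish before the diagonal, so the mixed prefix condition at
-- (k-1, k-1) reads a_kk - a_{k-1,k-1} ≥ 0, forcing a_kk = 1 ∈ {0, ±1} (for the last index the row sum does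
-- it instead, for k = 0 the hypothesis). The prefix conditions make every entry of row k and of
-- column k nonnegative, and since row and column sums equal 1 = a_kk, all other entries vanish.
module Submission where

open import Defs
open import Data.Nat as ℕ using (ℕ; suc; _<_; _∸_; _<?_; _≟_)
open import Data.Nat.Properties
  using (m<n⇒m<1+n; n<1+n; m<1+n⇒m<n∨m≡n; >⇒≢; <⇒≤; <-trans; <-≤-trans; <-cmp; ≮⇒≥; ∸-monoˡ-≤)
  renaming (≤-refl to ℕ-≤-refl; ≤-antisym to ℕ-≤-antisym)
open import Data.Nat.Induction using (<-rec)
open import Data.Fin using (Fin; zero; toℕ; fromℕ<)
open import Data.Fin.Properties using (toℕ-fromℕ<; fromℕ<-toℕ; toℕ<n; toℕ-injective)
open import Data.Integer using (ℤ; 0ℤ; 1ℤ; -1ℤ; _+_; _-_; -_; _≤_; +≤+; nonNegative)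
  renaming (+_ to ℤ+)
open import Data.Integer.Properties
  using (+-identityˡ; +-identityʳ; +-assoc; +-comm; +-inverseʳ; +-mono-≤; +-monoˡ-≤; +-monoʳ-≤;
         i≤i+j; i≤j+i; ≤-trans; ≤-reflexive; ≤-antisym; 0≤i-j⇒j≤i; module ≤-Reasoning)
open import Data.Product using (_,_; proj₁)
open import Data.Sum using (_⊎_; inj₁; inj₂)
open import Function using (_∘_)
open import Relation.Nullary using (yes; no; contradiction)
open import Relation.Binary.Definitions using (tri<; tri≈; tri>)
open import Relation.Binary.PropositionalEquality
  using (_≡_; _≢_; refl; sym; trans; cong; cong₂; subst; module ≡-Reasoning)

i+j≤j⇒i≤0 : ∀ {i j} → i + j ≤ j → i ≤ 0ℤ
i+j≤j⇒i≤0 {i} {j} i+j≤j = begin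
  i            ≡⟨ +-identityʳ i ⟨
  i + 0ℤ       ≡⟨ cong (i +_) (+-inverseʳ j) ⟨
  i + (j - j)  ≡⟨ +-assoc i j (- j) ⟨
  i + j - j    ≤⟨ +-monoˡ-≤ (- j) i+j≤j ⟩
  j - j        ≡⟨ +-inverseʳ j ⟩
  0ℤ           ∎
  where open ≤-Reasoning

Trit : ℤ → Set
Trit x = x ≡ 0ℤ ⊎ x ≡ 1ℤ ⊎ x ≡ -1ℤ

Trit-≥1⇒≡1 : ∀ {x} → Trit x → 1ℤ ≤ x → x ≡ 1ℤ
Trit-≥1⇒≡1 (inj₁ refl)        (+≤+ ())
Trit-≥1⇒≡1 (inj₂ (inj₁ refl)) _ = refl
Trit-≥1⇒≡1 (inj₂ (inj₂ refl)) ()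

NonNegOn : ℕ → (ℕ → ℤ) → Set
NonNegOn m f = ∀ i → i < m → 0ℤ ≤ f i

NonNegOn-pred : ∀ {m f} → NonNegOn (suc m) f → NonNegOn m f
NonNegOn-pred f≥0 i i<m = f≥0 i (m<n⇒m<1+n i<m)

sumTo-≡0 : ∀ m (f : ℕ → ℤ) → (∀ i → i < m → f i ≡ 0ℤ) → sumTo m f ≡ 0ℤ
sumTo-≡0 0       f f≡0 = refl
sumTo-≡0 (suc m) f f≡0 =
  cong₂ _+_ (sumTo-≡0 m f (λ i i<m → f≡0 i (m<n⇒m<1+n i<m))) (f≡0 m (n<1+n m))

sumTo-nonNeg : ∀ m f → NonNegOn m f → 0ℤ ≤ sumTo m f
sumTo-nonNeg 0       f f≥0 = +≤+ ℕ.z≤n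
sumTo-nonNeg (suc m) f f≥0 = +-mono-≤ (sumTo-nonNeg m f (NonNegOn-pred f≥0)) (f≥0 m (n<1+n m))

term≤sumTo : ∀ m f → NonNegOn m f → ∀ {i} → i < m → f i ≤ sumTo m f
term≤sumTo (suc m) f f≥0 i<1+m with m<1+n⇒m<n∨m≡n i<1+m
... | inj₁ i<m  = ≤-trans (term≤sumTo m f (NonNegOn-pred f≥0) i<m)
                          (i≤i+j _ (f m) {{nonNegative (f≥0 m (n<1+n m))}})
... | inj₂ refl = i≤j+i (f m) (sumTo m f) {{nonNegative (sumTo-nonNeg m f (NonNegOn-pred f≥0))}}

two-terms≤sumTo : ∀ m f → NonNegOn m f → ∀ {i k} → i < m → k < m → i ≢ k →
                  f i + f k ≤ sumTo m f
two-terms≤sumTo (suc m) f f≥0 {i} {k} i<1+m k<1+m i≢k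
  with m<1+n⇒m<n∨m≡n i<1+m | m<1+n⇒m<n∨m≡n k<1+m
... | inj₂ refl | inj₂ refl = contradiction refl i≢k
... | inj₂ refl | inj₁ k<m  = subst (f m + f k ≤_) (+-comm (f m) (sumTo m f))
                                (+-monoʳ-≤ (f m) (term≤sumTo m f (NonNegOn-pred f≥0) k<m))
... | inj₁ i<m  | inj₂ refl = +-monoˡ-≤ (f m) (term≤sumTo m f (NonNegOn-pred f≥0) i<m)
... | inj₁ i<m  | inj₁ k<m  = ≤-trans (two-terms≤sumTo m f (NonNegOn-pred f≥0) i<m k<m i≢k)
                                      (i≤i+j _ (f m) {{nonNegative (f≥0 m (n<1+n m))}})

sumTo-concentrated : ∀ m f → NonNegOn m f → ∀ {k} → k < m → sumTo m f ≡ f k →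
                     ∀ {j} → j < m → j ≢ k → f j ≡ 0ℤ
sumTo-concentrated m f f≥0 {k} k<m Σ≡fk {j} j<m j≢k = ≤-antisym
  (i+j≤j⇒i≤0 (subst (f j + f k ≤_) Σ≡fk (two-terms≤sumTo m f f≥0 j<m k<m j≢k)))
  (f≥0 j j<m)

column : (ℕ → ℕ → ℤ) → ℕ → ℕ → ℤ
column a j i = a i j

record PrefixConditions (m : ℕ) (a : ℕ → ℕ → ℤ) : Set where
  field
    diagonal-trit   : ∀ {k} → k < m → Trit (a k k)
    row-sum         : ∀ {i} → i < m → sumTo m (a i) ≡ 1ℤ
    column-sum      : ∀ {j} → j < m → sumTo m (column a j) ≡ 1ℤ
    row-prefix≥0    : ∀ {i j} → i < m → j < m → 0ℤ ≤ sumTo (suc j) (a i)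
    column-prefix≥0 : ∀ {i j} → i < m → j < m → 0ℤ ≤ sumTo (suc i) (column a j)
    mixed-prefix≥0  : ∀ {k} → suc k ℕ.≤ m ∸ 2 →
      0ℤ ≤ sumTo (suc k) (a (suc k)) + sumTo (suc (suc k)) (column a (suc k))
             - sumTo (suc k) (column a k)

module Forcing {m a} (P : PrefixConditions m a) (a00≡1 : a 0 0 ≡ 1ℤ) where
  open PrefixConditions P

  record Settled (k : ℕ) : Set where
    field
      diagonal   : a k k ≡ 1ℤ
      row-off    : ∀ {j} → j < m → j ≢ k → a k j ≡ 0ℤ
      column-off : ∀ {i} → i < m → i ≢ k → a i k ≡ 0ℤ

  SettledBelow : ℕ → Set
  SettledBelow k = ∀ {k′} → k′ < k → Settled k′

  row-head≡0 : ∀ {k} → SettledBelow k → ∀ {i} → k ℕ.≤ i → i < m → sumTo k (a i) ≡ 0ℤ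
  row-head≡0 {k} below k≤i i<m = sumTo-≡0 k _ λ j j<k →
    Settled.column-off (below j<k) i<m (>⇒≢ (<-≤-trans j<k k≤i))

  column-head≡0 : ∀ {k} → SettledBelow k → ∀ {j} → k ℕ.≤ j → j < m → sumTo k (column a j) ≡ 0ℤ
  column-head≡0 {k} below k≤j j<m = sumTo-≡0 k _ λ i i<k →
    Settled.row-off (below i<k) j<m (>⇒≢ (<-≤-trans i<k k≤j))

  diagonal≡1 : ∀ {k} → SettledBelow k → k < m → a k k ≡ 1ℤ
  diagonal≡1 {0}     _     _   = a00≡1
  diagonal≡1 {suc k} below k<m with suc (suc k) <? m
  ... | no k+1≮m = begin
    a (suc k) (suc k)                  ≡⟨ +-identityˡ _ ⟨
    0ℤ + a (suc k) (suc k)             ≡⟨ cong (_+ a (suc k) (suc k)) (row-head≡0 below ℕ-≤-refl k<m) ⟨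
    sumTo (suc (suc k)) (a (suc k))    ≡⟨ cong (λ l → sumTo l (a (suc k))) (ℕ-≤-antisym k<m (≮⇒≥ k+1≮m)) ⟩
    sumTo m (a (suc k))                ≡⟨ row-sum k<m ⟩
    1ℤ                                 ∎
    where open ≡-Reasoning
  ... | yes k+1<m = Trit-≥1⇒≡1 (diagonal-trit k<m)
    (0≤i-j⇒j≤i (subst (0ℤ ≤_) mixed≡akk-1 (mixed-prefix≥0 (∸-monoˡ-≤ 2 k+1<m))))
    where
    open ≡-Reasoning
    mixed≡akk-1 : sumTo (suc k) (a (suc k)) + sumTo (suc (suc k)) (column a (suc k))
                    - sumTo (suc k) (column a k)
                  ≡ a (suc k) (suc k) - 1ℤ
    mixed≡akk-1 = begin
      sumTo (suc k) (a (suc k)) + sumTo (suc (suc k)) (column a (suc k)) - sumTo (suc k) (column a k)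
        ≡⟨ cong₂ _-_
             (cong₂ _+_ (row-head≡0 below ℕ-≤-refl k<m)
                        (cong (_+ a (suc k) (suc k)) (column-head≡0 below ℕ-≤-refl k<m)))
             (cong₂ _+_ (column-head≡0 (below ∘ m<n⇒m<1+n) ℕ-≤-refl (<-trans (n<1+n k) k<m))
                        (Settled.diagonal (below (n<1+n k)))) ⟩
      0ℤ + (0ℤ + a (suc k) (suc k)) - 1ℤ
        ≡⟨ cong (_- 1ℤ) (trans (+-identityˡ _) (+-identityˡ (a (suc k) (suc k)))) ⟩
      a (suc k) (suc k) - 1ℤ
        ∎

  row-nonNeg : ∀ {k} → SettledBelow k → k < m → a k k ≡ 1ℤ → NonNegOn m (a k)
  row-nonNeg {k} below k<m akk≡1 j j<m with <-cmp j k
  ... | tri< j<k _ _ = ≤-reflexive (sym (Settled.column-off (below j<k) k<m (>⇒≢ j<k)))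
  ... | tri≈ _ refl _ = subst (0ℤ ≤_) (sym akk≡1) (+≤+ ℕ.z≤n)
  ... | tri> _ _ k<j = subst (0ℤ ≤_)
    (trans (cong (_+ a k j) (column-head≡0 below (<⇒≤ k<j) j<m)) (+-identityˡ _))
    (column-prefix≥0 k<m j<m)

  column-nonNeg : ∀ {k} → SettledBelow k → k < m → a k k ≡ 1ℤ → NonNegOn m (column a k)
  column-nonNeg {k} below k<m akk≡1 i i<m with <-cmp i k
  ... | tri< i<k _ _ = ≤-reflexive (sym (Settled.row-off (below i<k) k<m (>⇒≢ i<k)))
  ... | tri≈ _ refl _ = subst (0ℤ ≤_) (sym akk≡1) (+≤+ ℕ.z≤n)
  ... | tri> _ _ k<i = subst (0ℤ ≤_)
    (trans (cong (_+ a i k) (row-head≡0 below (<⇒≤ k<i) i<m)) (+-identityˡ _))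
    (row-prefix≥0 i<m k<m)

  settled-step : ∀ {k} → SettledBelow k → k < m → Settled k
  settled-step {k} below k<m = record
    { diagonal   = akk≡1
    ; row-off    = sumTo-concentrated m (a k) (row-nonNeg below k<m akk≡1) k<m
                     (trans (row-sum k<m) (sym akk≡1))
    ; column-off = sumTo-concentrated m (column a k) (column-nonNeg below k<m akk≡1) k<m
                     (trans (column-sum k<m) (sym akk≡1))
    }
    where akk≡1 = diagonal≡1 below k<m

  settled : ∀ {k} → k < m → Settled k
  settled {k} = <-rec (λ k → k < m → Settled k)
    (λ k rec k<m → settled-step (λ k′<k → rec k′<k (<-trans k′<k k<m)) k<m) k

entry-toℕ : ∀ {n} (A : Matrix n) (i j : Fin n) → entry A (toℕ i) (toℕ j) ≡ A i j
entry-toℕ {n} A i j with toℕ i <? n | toℕ j <? n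
... | yes i<n | yes j<n = cong₂ A (fromℕ<-toℕ i i<n) (fromℕ<-toℕ j j<n)
... | no i≮n  | _       = contradiction (toℕ<n i) i≮n
... | yes _   | no j≮n  = contradiction (toℕ<n j) j≮n

∀Fin⇒∀< : ∀ {n} (Q : ℕ → Set) → (∀ (i : Fin n) → Q (toℕ i)) → ∀ {i} → i < n → Q i
∀Fin⇒∀< Q h i<n = subst Q (toℕ-fromℕ< i<n) (h (fromℕ< i<n))

∀Fin²⇒∀< : ∀ {n} (Q : ℕ → ℕ → Set) → (∀ (i j : Fin n) → Q (toℕ i) (toℕ j)) →
           ∀ {i j} → i < n → j < n → Q i j
∀Fin²⇒∀< Q h i<n = ∀Fin⇒∀< (λ i → ∀ {j} → j < _ → Q i j) (λ i → ∀Fin⇒∀< (Q (toℕ i)) (h i)) i<n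

isMagog⇒prefixConditions : ∀ {n} {A : Matrix (suc n)} → IsMagog (suc n) A →
                           PrefixConditions (suc n) (entry A)
isMagog⇒prefixConditions {A = A} (trits , rows , columns , colPre-bounds , rowPre≥0 , mixed) = record
  { diagonal-trit   = ∀Fin⇒∀< (λ k → Trit (entry A k k))
                        (λ i → subst Trit (sym (entry-toℕ A i i)) (trits i i))
  ; row-sum         = ∀Fin⇒∀< _ rows
  ; column-sum      = ∀Fin⇒∀< _ columns
  ; row-prefix≥0    = ∀Fin²⇒∀< _ rowPre≥0
  ; column-prefix≥0 = ∀Fin²⇒∀< _ (λ i j → proj₁ (colPre-bounds i j))
  ; mixed-prefix≥0  = λ {k} k<n∸1 → mixed k k k<n∸1 k<n∸1
  }

≡-idMatrix : ∀ {n} (A : Matrix n) → (∀ i → A i i ≡ 1ℤ) →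
             (∀ i j → toℕ i ≢ toℕ j → A i j ≡ 0ℤ) → ∀ i j → A i j ≡ idMatrix n i j
≡-idMatrix A diag off i j with toℕ i ≟ toℕ j
... | yes i≡j rewrite toℕ-injective i≡j = diag j
... | no i≢j = off i j i≢j

lemma3p11 : (n : ℕ) (A : Matrix (suc n)) → IsMagog (suc n) A →
    A zero zero ≡ ℤ+ 1 → ∀ (i j : Fin (suc n)) → A i j ≡ idMatrix (suc n) i j
lemma3p11 n A M a00≡1 = ≡-idMatrix A
  (λ i → trans (sym (entry-toℕ A i i)) (Settled.diagonal (settled (toℕ<n i))))
  (λ i j i≢j → trans (sym (entry-toℕ A i j)) (Settled.row-off (settled (toℕ<n i)) (toℕ<n j) (i≢j ∘ sym)))
  where open Forcing (isMagog⇒prefixConditions M) (trans (entry-toℕ A zero zero) a00≡1)
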